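{- Let $r$ be a positive integer, $s_1,s_2$ positive integers and $i_1,i_2$ non-negative integers. For each $k\in\{1,\ldots,r-1\}$: (C.1) if $(r-k)\frac{r}{r+1}s_1\le i_1<(r-k)s_1$ and $0\le i_2<ks_2$, then $D(i_1,i_2,r,s_1,s_2)\le s_2\frac{i_1}{r}+\frac{i_2}{r}\frac{i_1}{r-k}$; (C.2) if $(r-k)\frac{r}{r+1}s_1\le i_1<(r-k)s_1$ and $ks_2\le i_2<(k+1)s_2$, then $D(i_1,i_2,r,s_1,s_2)\le s_2\frac{i_1}{r}+((k+1)s_2-i_2)\big(\frac{i_1}{r-k}-\frac{i_1}{r}\big)+(i_2-ks_2)\big(s_1-\frac{i_1}{r}\big)$; (C.3) if $(r-k-1)s_1\le i_1<(r-k)\frac{r}{r+1}s_1$ and $0\le i_2<(k+1)s_2$, then $D(i_1,i_2,r,s_1,s_2)\le s_2\frac{i_1}{r}+\frac{i_2}{k+1}\big(s_1-\frac{i_1}{r}\big)$. Finally, (C.4) if $s_1(r-1)\le i_1<s_1r$ and $0\le i_2<s_2$, then $D(i_1,i_2,r,s_1,s_2)=s_2\lfloor\frac{i_1}{r}\rfloor+i_2\big(s_1-\lfloor\frac{i_1}{r}\rfloor\big)$. Each of the numbers given in (C.1)–(C.4) is at most $\min\{(i_1s_2+s_1i_2)/r,\ s_1s_2\}$.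
   Context: For $r\in\mathbf{N}$, $i_1\in\mathbf{N}_0$, $s_1\in\mathbf{N}$ let $D(i_1,r,s_1)=\min\{\lfloor i_1/r\rfloor,s_1\}$, and for $i_2\in\mathbf{N}_0$, $s_2\in\mathbf{N}$ let $$D(i_1,i_2,r,s_1,s_2)=\max\Big\{(s_2-u_1-\cdots-u_r)D(i_1,r,s_1)+\sum_{j=1}^{r-1}u_jD(i_1,r-j,s_1)+u_rs_1\Big\},$$ the maximum taken over all $(u_1,\ldots,u_r)\in\mathbf{N}_0^r$ with $u_1+\cdots+u_r\le s_2$ and $u_1+2u_2+\cdots+ru_r\le i_2$. (By a separate result, $D(i_1,i_2,r,s_1,s_2)$ bounds the number of zeros of multiplicity at least $r$ on $S_1\times S_2$, $|S_j|=s_j$, of a polynomial with lexicographic leading monomial $X_1^{i_1}X_2^{i_2}$, $X_2\prec X_1$.) -}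

module Defs where

open import Data.Nat using (ℕ; zero; suc; _+_; _*_; _∸_; _≤_; _≤?_; _⊔_; _⊓_; NonZero)
open import Data.Nat.DivMod using (_/_)
open import Data.Fin using (Fin; toℕ)
open import Data.Vec using (Vec; []; _∷_; lookup; toList)
open import Data.List using (List; []; _∷_; [_]; map; concatMap; upTo; filter; foldr)
open import Data.Nat.ListAction using (sum)
open import Data.Product using (_×_)
open import Relation.Nullary.Decidable using (_×-dec_)
open import Data.Integer using (+_)
import Data.Rational as ℚ
open ℚ using (ℚ)

D₁ : (i₁ r s₁ : ℕ) → .{{_ : NonZero r}} → ℕ
D₁ i₁ r s₁ = (i₁ / r) ⊓ s₁

-- Coefficient of u_j (j = toℕ idx + 1 ∈ {1,…,r}) in the objective:
-- D(i₁, r - j, s₁) for j < r, and s₁ for j = r.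
coef : (i₁ r s₁ : ℕ) → Fin r → ℕ
coef i₁ r s₁ idx with r ∸ suc (toℕ idx)
... | zero  = s₁
... | suc m = D₁ i₁ (suc m) s₁

sumU : {r : ℕ} → Vec ℕ r → ℕ
sumU u = sum (toList u)

wsumU : {r : ℕ} → Vec ℕ r → ℕ
wsumU {r} u = sum (toList (Data.Vec.tabulate {n = r} λ idx → suc (toℕ idx) * lookup u idx))

objective : (i₁ r s₁ s₂ : ℕ) → .{{_ : NonZero r}} → Vec ℕ r → ℕ
objective i₁ r s₁ s₂ u =
  (s₂ ∸ sumU u) * D₁ i₁ r s₁
  + sum (toList (Data.Vec.tabulate {n = r} λ idx → lookup u idx * coef i₁ r s₁ idx))

allVecs : (r b : ℕ) → List (Vec ℕ r)
allVecs zero    b = [ [] ]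
allVecs (suc r) b = concatMap (λ x → map (x ∷_) (allVecs r b)) (upTo (suc b))

-- D(i₁, i₂, r, s₁, s₂): maximum of the objective over admissible tuples
-- (u ∈ ℕ₀^r with Σ u_j ≤ s₂ and Σ j u_j ≤ i₂).
-- (Admissible tuples have all entries ≤ s₂, so enumerating {0..s₂}^r suffices;
--  the zero tuple is admissible, so the default 0 of the fold is harmless.)
D₂ : (i₁ i₂ r s₁ s₂ : ℕ) → .{{_ : NonZero r}} → ℕ
D₂ i₁ i₂ r s₁ s₂ =
  foldr _⊔_ 0
    (map (objective i₁ r s₁ s₂)
      (filter (λ u → (sumU u ≤? s₂) ×-dec (wsumU u ≤? i₂)) (allVecs r s₂)))

⟦_⟧ : ℕ → ℚ
⟦ n ⟧ = + n ℚ./ 1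

-- n / d as a rational; only ever applied with d ≠ 0 (value 0 for d = 0 is a dummy)
frac : ℕ → ℕ → ℚ
frac n zero    = ℚ.0ℚ
frac n (suc d) = + n ℚ./ suc d

-- D(i₁, i₂, r, s₁, s₂) is the optimum of an integer linear program in u = (u₁, …, u_r) with
-- constraints Σ uⱼ ≤ s₂ and Σ j uⱼ ≤ i₂, whose objective coefficients cⱼ = D(i₁, r - j, s₁)
-- (and c₀ = D(i₁, r, s₁)) enter only through cⱼ ≤ s₁ and (r - j) cⱼ ≤ i₁.  Every upper bound
-- comes from weak duality: if N cⱼ ≤ A + j L for all such cⱼ, then N D ≤ s₂ A + i₂ L.  Each
-- regime supplies such a certificate (N, A, L), treating j ≤ k and j > k separately, whose
-- value is the claimed rational bound with its denominator N cleared; the comparisons with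
-- min {(i₁ s₂ + s₁ i₂) / r, s₁ s₂} then become inequalities between natural numbers.
-- In (C.4) the vertex u = (i₂, 0, …, 0) is feasible and attains the bound.
module Submission where

open import Defs
open import Data.Nat using (ℕ; suc; _+_; _*_; _∸_; _≤_; _<_; NonZero)
open import Data.Nat.DivMod using (_/_)
open import Data.Product using (_×_)
open import Relation.Binary.PropositionalEquality using (_≡_)
open import Data.Rational using (ℚ) renaming (_+_ to _+ℚ_; _*_ to _*ℚ_; _-_ to _-ℚ_; _≤_ to _≤ℚ_; _<_ to _<ℚ_; _⊓_ to _⊓ℚ_)

open import Data.Nat using (zero; z≤n; s≤s; _≤?_; >-nonZero; >-nonZero⁻¹)
open import Data.Nat.Properties
open import Data.Nat.DivMod using (m/n*n≤m; m*n/n≡m; /-monoˡ-≤; m<n*o⇒m/o<n)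
open import Data.Nat.ListAction using (sum)
open import Data.Nat.Tactic.RingSolver using (solve-∀)
open import Data.Nat.Coprimality using (1-coprimeTo) renaming (sym to coprime-sym)
import Data.Integer as ℤ
import Data.Integer.Properties as ℤₚ
open import Data.Rational using (mkℚ; Positive; *≤*) renaming (_/_ to _/ℚ_)
import Data.Rational.Properties as ℚ
import Data.Rational.Unnormalised as ℚᵘ
import Data.Rational.Unnormalised.Properties as ℚᵘ
open import Data.Rational.Solver using (module +-*-Solver)
open +-*-Solver using (_:+_; _:*_; _:-_; _:=_) renaming (solve to solveℚ)
open import Data.Fin using (Fin; zero; suc; toℕ)
open import Data.Vec using (Vec; []; _∷_; lookup; toList; tabulate; replicate)
open import Data.Vec.Properties using (lookup-replicate)
open import Data.List using (map)
open import Data.List.Properties using (foldr-preservesᵇ; foldr-preservesᵒ)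
import Data.List.Relation.Unary.All as All
open import Data.List.Relation.Unary.All.Properties using (all-filter) renaming (map⁺ to All-map⁺)
import Data.List.Relation.Unary.Any as Any
open import Data.List.Membership.Propositional using (_∈_)
open import Data.List.Membership.Propositional.Properties using (∈-map⁺; ∈-concatMap⁺; ∈-upTo⁺; ∈-filter⁺)
open import Data.Product using (_,_; proj₁; proj₂)
open import Data.Sum using (inj₁; inj₂)
open import Relation.Nullary.Decidable using (_×-dec_; yes; no)
open import Relation.Unary using (Decidable)
open import Relation.Binary.PropositionalEquality using (refl; sym; trans; cong; cong₂; subst; subst₂; module ≡-Reasoning)

-- Natural numbers as rationals

⟦⟧≡mkℚ : ∀ n → ⟦ n ⟧ ≡ mkℚ (ℤ.+ n) 0 (coprime-sym (1-coprimeTo n))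
⟦⟧≡mkℚ n = ℚ.normalize-coprime (coprime-sym (1-coprimeTo n))

⟦⟧-+ : ∀ m n → ⟦ m + n ⟧ ≡ ⟦ m ⟧ +ℚ ⟦ n ⟧
⟦⟧-+ m n rewrite ⟦⟧≡mkℚ m | ⟦⟧≡mkℚ n = cong (_/ℚ 1)
  (trans (ℤₚ.pos-+ m n) (sym (cong₂ ℤ._+_ (ℤₚ.*-identityʳ (ℤ.+ m)) (ℤₚ.*-identityʳ (ℤ.+ n)))))

⟦⟧-* : ∀ m n → ⟦ m * n ⟧ ≡ ⟦ m ⟧ *ℚ ⟦ n ⟧
⟦⟧-* m n rewrite ⟦⟧≡mkℚ m | ⟦⟧≡mkℚ n = cong (_/ℚ 1) (ℤₚ.pos-* m n)

⟦⟧-∸ : ∀ {m n} → n ≤ m → ⟦ m ∸ n ⟧ ≡ ⟦ m ⟧ -ℚ ⟦ n ⟧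
⟦⟧-∸ {m} {n} n≤m = begin
  ⟦ m ∸ n ⟧                       ≡⟨ solveℚ 2 (λ x y → x := x :+ y :- y) refl ⟦ m ∸ n ⟧ ⟦ n ⟧ ⟩
  ⟦ m ∸ n ⟧ +ℚ ⟦ n ⟧ -ℚ ⟦ n ⟧     ≡⟨ cong (_-ℚ ⟦ n ⟧) (⟦⟧-+ (m ∸ n) n) ⟨
  ⟦ m ∸ n + n ⟧ -ℚ ⟦ n ⟧          ≡⟨ cong (λ x → ⟦ x ⟧ -ℚ ⟦ n ⟧) (m∸n+n≡m n≤m) ⟩
  ⟦ m ⟧ -ℚ ⟦ n ⟧                  ∎
  where open ≡-Reasoning

⟦⟧-mono-≤ : ∀ {m n} → m ≤ n → ⟦ m ⟧ ≤ℚ ⟦ n ⟧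
⟦⟧-mono-≤ {m} {n} m≤n rewrite ⟦⟧≡mkℚ m | ⟦⟧≡mkℚ n =
  *≤* (subst₂ ℤ._≤_ (sym (ℤₚ.*-identityʳ (ℤ.+ m))) (sym (ℤₚ.*-identityʳ (ℤ.+ n))) (ℤ.+≤+ m≤n))

⟦⟧-cancel-≤ : ∀ {m n} → ⟦ m ⟧ ≤ℚ ⟦ n ⟧ → m ≤ n
⟦⟧-cancel-≤ {m} {n} m≤n rewrite ⟦⟧≡mkℚ m | ⟦⟧≡mkℚ n
  with subst₂ ℤ._≤_ (ℤₚ.*-identityʳ (ℤ.+ m)) (ℤₚ.*-identityʳ (ℤ.+ n)) (ℚ.drop-*≤* m≤n)
... | ℤ.+≤+ m≤n = m≤n

⟦⟧-cancel-< : ∀ {m n} → ⟦ m ⟧ <ℚ ⟦ n ⟧ → m < n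
⟦⟧-cancel-< {m} {n} m<n rewrite ⟦⟧≡mkℚ m | ⟦⟧≡mkℚ n
  with subst₂ ℤ._<_ (ℤₚ.*-identityʳ (ℤ.+ m)) (ℤₚ.*-identityʳ (ℤ.+ n)) (ℚ.drop-*<* m<n)
... | ℤ.+<+ m<n = m<n

⟦⟧-pos : ∀ n .{{_ : NonZero n}} → Positive ⟦ n ⟧
⟦⟧-pos n = ℚ.normalize-pos n 1

infix 4 _·_≡⟦_⟧

-- A record rather than a type alias, so that N, P and x can be inferred.
record _·_≡⟦_⟧ (N : ℕ) (P : ℚ) (x : ℕ) : Set where
  constructor scaled
  field eq : ⟦ N ⟧ *ℚ P ≡ ⟦ x ⟧

·-frac : ∀ n d .{{_ : NonZero d}} → d · frac n d ≡⟦ n ⟧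
·-frac n (suc d) = scaled (ℚ.toℚᵘ-injective (ℚᵘ.≃-trans (ℚ.toℚᵘ-homo-* ⟦ suc d ⟧ (frac n (suc d)))
  (ℚᵘ.≃-trans (ℚᵘ.*-cong (ℚ.toℚᵘ-fromℚᵘ (ℚᵘ.mkℚᵘ (ℤ.+ suc d) 0)) (ℚ.toℚᵘ-fromℚᵘ (ℚᵘ.mkℚᵘ (ℤ.+ n) d)))
  (ℚᵘ.≃-trans cancel (ℚᵘ.≃-sym (ℚ.toℚᵘ-fromℚᵘ (ℚᵘ.mkℚᵘ (ℤ.+ n) 0)))))))
  where
  cancel : ℚᵘ.mkℚᵘ (ℤ.+ suc d) 0 ℚᵘ.* ℚᵘ.mkℚᵘ (ℤ.+ n) d ℚᵘ.≃ ℚᵘ.mkℚᵘ (ℤ.+ n) 0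
  cancel = ℚᵘ.*≡* (trans (trans (ℤₚ.*-identityʳ _) (ℤₚ.*-comm (ℤ.+ suc d) (ℤ.+ n)))
    (cong (λ e → ℤ.+ n ℤ.* ℤ.+ suc e) (sym (+-identityʳ d))))

·-⟦⟧ : ∀ N x → N · ⟦ x ⟧ ≡⟦ N * x ⟧
·-⟦⟧ N x = scaled (sym (⟦⟧-* N x))

module _ {N : ℕ} {P : ℚ} {x : ℕ} where

  ·-*ˡ : ∀ a → N · P ≡⟦ x ⟧ → N · ⟦ a ⟧ *ℚ P ≡⟦ a * x ⟧
  ·-*ˡ a (scaled NP≡x) = scaled (begin
    ⟦ N ⟧ *ℚ (⟦ a ⟧ *ℚ P)   ≡⟨ solveℚ 3 (λ n a p → n :* (a :* p) := a :* (n :* p)) refl ⟦ N ⟧ ⟦ a ⟧ P ⟩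
    ⟦ a ⟧ *ℚ (⟦ N ⟧ *ℚ P)   ≡⟨ cong (⟦ a ⟧ *ℚ_) NP≡x ⟩
    ⟦ a ⟧ *ℚ ⟦ x ⟧          ≡⟨ ⟦⟧-* a x ⟨
    ⟦ a * x ⟧               ∎)
    where open ≡-Reasoning

  ·-*ʳ : ∀ a → N · P ≡⟦ x ⟧ → N · P *ℚ ⟦ a ⟧ ≡⟦ x * a ⟧
  ·-*ʳ a (scaled NP≡x) = scaled (begin
    ⟦ N ⟧ *ℚ (P *ℚ ⟦ a ⟧)   ≡⟨ ℚ.*-assoc ⟦ N ⟧ P ⟦ a ⟧ ⟨
    ⟦ N ⟧ *ℚ P *ℚ ⟦ a ⟧     ≡⟨ cong (_*ℚ ⟦ a ⟧) NP≡x ⟩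
    ⟦ x ⟧ *ℚ ⟦ a ⟧          ≡⟨ ⟦⟧-* x a ⟨
    ⟦ x * a ⟧               ∎)
    where open ≡-Reasoning

  ·-scaleˡ : ∀ K → N · P ≡⟦ x ⟧ → K * N · P ≡⟦ K * x ⟧
  ·-scaleˡ K (scaled NP≡x) = scaled (begin
    ⟦ K * N ⟧ *ℚ P          ≡⟨ cong (_*ℚ P) (⟦⟧-* K N) ⟩
    ⟦ K ⟧ *ℚ ⟦ N ⟧ *ℚ P     ≡⟨ ℚ.*-assoc ⟦ K ⟧ ⟦ N ⟧ P ⟩
    ⟦ K ⟧ *ℚ (⟦ N ⟧ *ℚ P)   ≡⟨ cong (⟦ K ⟧ *ℚ_) NP≡x ⟩
    ⟦ K ⟧ *ℚ ⟦ x ⟧          ≡⟨ ⟦⟧-* K x ⟨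
    ⟦ K * x ⟧               ∎)
    where open ≡-Reasoning

  ·-scaleʳ : ∀ K → N · P ≡⟦ x ⟧ → N * K · P ≡⟦ K * x ⟧
  ·-scaleʳ K P≐x = subst (_· P ≡⟦ K * x ⟧) (*-comm K N) (·-scaleˡ K P≐x)

  module _ {Q : ℚ} {y : ℕ} where

    ·-+ : N · P ≡⟦ x ⟧ → N · Q ≡⟦ y ⟧ → N · P +ℚ Q ≡⟦ x + y ⟧
    ·-+ (scaled NP≡x) (scaled NQ≡y) = scaled (begin
      ⟦ N ⟧ *ℚ (P +ℚ Q)          ≡⟨ ℚ.*-distribˡ-+ ⟦ N ⟧ P Q ⟩
      ⟦ N ⟧ *ℚ P +ℚ ⟦ N ⟧ *ℚ Q   ≡⟨ cong₂ _+ℚ_ NP≡x NQ≡y ⟩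
      ⟦ x ⟧ +ℚ ⟦ y ⟧             ≡⟨ ⟦⟧-+ x y ⟨
      ⟦ x + y ⟧                  ∎)
      where open ≡-Reasoning

    ·-∸ : N · P ≡⟦ x ⟧ → N · Q ≡⟦ y ⟧ → y ≤ x → N · P -ℚ Q ≡⟦ x ∸ y ⟧
    ·-∸ (scaled NP≡x) (scaled NQ≡y) y≤x = scaled (begin
      ⟦ N ⟧ *ℚ (P -ℚ Q)          ≡⟨ solveℚ 3 (λ n p q → n :* (p :- q) := n :* p :- n :* q) refl ⟦ N ⟧ P Q ⟩
      ⟦ N ⟧ *ℚ P -ℚ ⟦ N ⟧ *ℚ Q   ≡⟨ cong₂ _-ℚ_ NP≡x NQ≡y ⟩
      ⟦ x ⟧ -ℚ ⟦ y ⟧             ≡⟨ ⟦⟧-∸ y≤x ⟨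
      ⟦ x ∸ y ⟧                  ∎)
      where open ≡-Reasoning

·-* : ∀ {N M P Q x y} → N · P ≡⟦ x ⟧ → M · Q ≡⟦ y ⟧ → N * M · P *ℚ Q ≡⟦ x * y ⟧
·-* {N} {M} {P} {Q} {x} {y} (scaled NP≡x) (scaled MQ≡y) = scaled (begin
  ⟦ N * M ⟧ *ℚ (P *ℚ Q)            ≡⟨ cong (_*ℚ (P *ℚ Q)) (⟦⟧-* N M) ⟩
  ⟦ N ⟧ *ℚ ⟦ M ⟧ *ℚ (P *ℚ Q)       ≡⟨ solveℚ 4 (λ n m p q → n :* m :* (p :* q) := n :* p :* (m :* q)) refl ⟦ N ⟧ ⟦ M ⟧ P Q ⟩
  ⟦ N ⟧ *ℚ P *ℚ (⟦ M ⟧ *ℚ Q)       ≡⟨ cong₂ _*ℚ_ NP≡x MQ≡y ⟩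
  ⟦ x ⟧ *ℚ ⟦ y ⟧                   ≡⟨ ⟦⟧-* x y ⟨
  ⟦ x * y ⟧                        ∎)
  where open ≡-Reasoning

module _ {N : ℕ} .{{_ : NonZero N}} {P Q : ℚ} {x y : ℕ} where

  ·-mono-≤ : N · P ≡⟦ x ⟧ → N · Q ≡⟦ y ⟧ → x ≤ y → P ≤ℚ Q
  ·-mono-≤ (scaled NP≡x) (scaled NQ≡y) x≤y =
    ℚ.*-cancelˡ-≤-pos ⟦ N ⟧ {{⟦⟧-pos N}} (subst₂ _≤ℚ_ (sym NP≡x) (sym NQ≡y) (⟦⟧-mono-≤ x≤y))

  ·-cancel-≤ : N · P ≡⟦ x ⟧ → N · Q ≡⟦ y ⟧ → P ≤ℚ Q → x ≤ y
  ·-cancel-≤ (scaled NP≡x) (scaled NQ≡y) P≤Q = ⟦⟧-cancel-≤ (subst₂ _≤ℚ_ NP≡x NQ≡y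
    (ℚ.*-monoˡ-≤-nonNeg ⟦ N ⟧ {{ℚ.pos⇒nonNeg ⟦ N ⟧ {{⟦⟧-pos N}}}} P≤Q))

  ·-cancel-< : N · P ≡⟦ x ⟧ → N · Q ≡⟦ y ⟧ → P <ℚ Q → x < y
  ·-cancel-< (scaled NP≡x) (scaled NQ≡y) P<Q =
    ⟦⟧-cancel-< (subst₂ _<ℚ_ NP≡x NQ≡y (ℚ.*-monoʳ-<-pos ⟦ N ⟧ {{⟦⟧-pos N}} P<Q))

·-bounds : ∀ r K .{{_ : NonZero r}} .{{_ : NonZero K}} {d X A B : ℕ} {Q : ℚ} →
  r * K · Q ≡⟦ X ⟧ → r * K * d ≤ X → X ≤ K * A → X ≤ r * K * B →
  ⟦ d ⟧ ≤ℚ Q × Q ≤ℚ frac A r ⊓ℚ ⟦ B ⟧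
·-bounds r K {d} {A = A} {B} Q≐X rKd≤X X≤KA X≤rKB =
  ·-mono-≤ (·-⟦⟧ (r * K) d) Q≐X rKd≤X ,
  ℚ.⊓-glb (·-mono-≤ Q≐X (·-scaleʳ K (·-frac A r)) X≤KA) (·-mono-≤ Q≐X (·-⟦⟧ (r * K) B) X≤rKB)
  where
  instance
    rK≢0 : NonZero (r * K)
    rK≢0 = m*n≢0 r K

-- The linear program defining D₂

m*[n/m]≤n : ∀ m n .{{_ : NonZero m}} → m * (n / m) ≤ n
m*[n/m]≤n m n = ≤-trans (≤-reflexive (*-comm m (n / m))) (m/n*n≤m n m)

m*n≤o⇒n≤o/m : ∀ {m n o} .{{_ : NonZero m}} → m * n ≤ o → n ≤ o / m
m*n≤o⇒n≤o/m {m} {n} {o} mn≤o =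
  ≤-trans (≤-reflexive (sym (m*n/n≡m n m))) (/-monoˡ-≤ m (≤-trans (≤-reflexive (*-comm n m)) mn≤o))

D₁-≤ : ∀ i₁ d s₁ .{{_ : NonZero d}} → D₁ i₁ d s₁ ≤ s₁ × d * D₁ i₁ d s₁ ≤ i₁
D₁-≤ i₁ d s₁ = m⊓n≤n (i₁ / d) s₁ , ≤-trans (*-monoʳ-≤ d (m⊓n≤m (i₁ / d) s₁)) (m*[n/m]≤n d i₁)

D₁-saturated : ∀ {i₁ d s₁} .{{_ : NonZero d}} → d * s₁ ≤ i₁ → D₁ i₁ d s₁ ≡ s₁
D₁-saturated ds₁≤i₁ = m≥n⇒m⊓n≡n (m*n≤o⇒n≤o/m ds₁≤i₁)

coef-≤ : ∀ i₁ r s₁ (i : Fin r) → coef i₁ r s₁ i ≤ s₁ × (r ∸ suc (toℕ i)) * coef i₁ r s₁ i ≤ i₁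
coef-≤ i₁ r s₁ i with r ∸ suc (toℕ i)
... | zero  = ≤-refl , z≤n
... | suc d = D₁-≤ i₁ (suc d) s₁

coef-saturated : ∀ i₁ r s₁ → r * s₁ ≤ i₁ → coef i₁ (suc r) s₁ zero ≡ s₁
coef-saturated i₁ zero    s₁ _      = refl
coef-saturated i₁ (suc r) s₁ rs₁≤i₁ = D₁-saturated rs₁≤i₁

∑ : ∀ {n} → (Fin n → ℕ) → ℕ
∑ f = sum (toList (tabulate f))

*-∑-weighted-≤ : ∀ {n} (u : Vec ℕ n) (c w : Fin n → ℕ) (N A L : ℕ) →
  (∀ i → N * c i ≤ A + w i * L) →
  N * ∑ (λ i → lookup u i * c i) ≤ sum (toList u) * A + ∑ (λ i → w i * lookup u i) * L
*-∑-weighted-≤ []       c w N A L bound = ≤-reflexive (*-zeroʳ N)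
*-∑-weighted-≤ (x ∷ xs) c w N A L bound = begin
  N * (x * c₀ + C)                    ≡⟨ reorder₁ N x c₀ C ⟩
  x * (N * c₀) + N * C                ≤⟨ +-mono-≤ (*-monoʳ-≤ x (bound zero)) IH ⟩
  x * (A + w₀ * L) + (S * A + W * L)  ≡⟨ reorder₂ x A w₀ L S W ⟩
  (x + S) * A + (w₀ * x + W) * L      ∎
  where
  open ≤-Reasoning
  c₀ = c zero
  w₀ = w zero
  C = ∑ (λ i → lookup xs i * c (suc i))
  S = sum (toList xs)
  W = ∑ (λ i → w (suc i) * lookup xs i)
  IH = *-∑-weighted-≤ xs (λ i → c (suc i)) (λ i → w (suc i)) N A L (λ i → bound (suc i))
  reorder₁ : ∀ N x c C → N * (x * c + C) ≡ x * (N * c) + N * C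
  reorder₁ = solve-∀
  reorder₂ : ∀ x A w L S W → x * (A + w * L) + (S * A + W * L) ≡ (x + S) * A + (w * x + W) * L
  reorder₂ = solve-∀

module _ (i₁ i₂ r s₁ s₂ : ℕ) .{{_ : NonZero r}} where

  admissible? : Decidable (λ (u : Vec ℕ r) → sumU u ≤ s₂ × wsumU u ≤ i₂)
  admissible? u = (sumU u ≤? s₂) ×-dec (wsumU u ≤? i₂)

  -- (A / N, L / N) is a feasible point of the linear program dual to the one defining D₂.
  DualFeasible : ℕ → ℕ → ℕ → Set
  DualFeasible N A L = ∀ j c → c ≤ s₁ → (r ∸ j) * c ≤ i₁ → N * c ≤ A + j * L

  *-objective-≤ : ∀ N A L → DualFeasible N A L → (u : Vec ℕ r) → sumU u ≤ s₂ →
    N * objective i₁ r s₁ s₂ u ≤ s₂ * A + wsumU u * L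
  *-objective-≤ N A L feasible u t≤s₂ = begin
    N * ((s₂ ∸ t) * D + C)            ≡⟨ reorder₁ N (s₂ ∸ t) D C ⟩
    (s₂ ∸ t) * (N * D) + N * C        ≤⟨ +-mono-≤ (*-monoʳ-≤ (s₂ ∸ t) ND≤A) NC≤ ⟩
    (s₂ ∸ t) * A + (t * A + w * L)    ≡⟨ reorder₂ (s₂ ∸ t) t A (w * L) ⟩
    (s₂ ∸ t + t) * A + w * L          ≡⟨ cong (λ s → s * A + w * L) (m∸n+n≡m t≤s₂) ⟩
    s₂ * A + w * L                    ∎
    where
    open ≤-Reasoning
    t = sumU u
    w = wsumU u
    D = D₁ i₁ r s₁
    C = ∑ (λ i → lookup u i * coef i₁ r s₁ i)
    ND≤A : N * D ≤ A
    ND≤A = ≤-trans (feasible 0 D (proj₁ (D₁-≤ i₁ r s₁)) (proj₂ (D₁-≤ i₁ r s₁))) (≤-reflexive (+-identityʳ A))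
    NC≤ : N * C ≤ t * A + w * L
    NC≤ = *-∑-weighted-≤ u (coef i₁ r s₁) (λ i → suc (toℕ i)) N A L
      (λ i → feasible (suc (toℕ i)) (coef i₁ r s₁ i) (proj₁ (coef-≤ i₁ r s₁ i)) (proj₂ (coef-≤ i₁ r s₁ i)))
    reorder₁ : ∀ N a D C → N * (a * D + C) ≡ a * (N * D) + N * C
    reorder₁ = solve-∀
    reorder₂ : ∀ a t A B → a * A + (t * A + B) ≡ (a + t) * A + B
    reorder₂ = solve-∀

  *-D₂-≤ : ∀ N A L → DualFeasible N A L → N * D₂ i₁ i₂ r s₁ s₂ ≤ s₂ * A + i₂ * L
  *-D₂-≤ N A L feasible =
    foldr-preservesᵇ {P = λ v → N * v ≤ s₂ * A + i₂ * L}
      (λ {v} {v′} Nv≤ Nv′≤ → ≤-trans (≤-reflexive (*-distribˡ-⊔ N v v′)) (⊔-lub Nv≤ Nv′≤))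
      (≤-trans (≤-reflexive (*-zeroʳ N)) z≤n)
      (All-map⁺ (All.map (λ {u} → admissible⇒≤ {u}) (all-filter admissible? (allVecs r s₂))))
    where
    admissible⇒≤ : ∀ {u} → sumU u ≤ s₂ × wsumU u ≤ i₂ → N * objective i₁ r s₁ s₂ u ≤ s₂ * A + i₂ * L
    admissible⇒≤ {u} (t≤s₂ , w≤i₂) =
      ≤-trans (*-objective-≤ N A L feasible u t≤s₂) (+-monoʳ-≤ (s₂ * A) (*-monoˡ-≤ L w≤i₂))

  objective-≤-D₂ : ∀ {u} → u ∈ allVecs r s₂ → sumU u ≤ s₂ → wsumU u ≤ i₂ →
    objective i₁ r s₁ s₂ u ≤ D₂ i₁ i₂ r s₁ s₂
  objective-≤-D₂ {u} u∈ t≤s₂ w≤i₂ =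
    foldr-preservesᵒ {P = objective i₁ r s₁ s₂ u ≤_}
      (λ { v v′ (inj₁ le) → ≤-trans le (m≤m⊔n v v′) ; v v′ (inj₂ le) → ≤-trans le (m≤n⊔m v v′) })
      0 _
      (inj₂ (Any.map (λ { refl → ≤-refl })
        (∈-map⁺ (objective i₁ r s₁ s₂) (∈-filter⁺ admissible? u∈ (t≤s₂ , w≤i₂)))))

allVecs-complete : ∀ {n} b (v : Vec ℕ n) → (∀ i → lookup v i ≤ b) → v ∈ allVecs n b
allVecs-complete b []      _       = Any.here refl
allVecs-complete b (x ∷ v) bounded = ∈-concatMap⁺ (λ y → map (y ∷_) (allVecs _ b))
  (Any.map (λ { refl → ∈-map⁺ (x ∷_) (allVecs-complete b v (λ i → bounded (suc i))) })
           (∈-upTo⁺ (s≤s (bounded zero))))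

module _ (x n : ℕ) where

  sumU-vertex₁ : sumU (x ∷ replicate n 0) ≡ x
  sumU-vertex₁ = trans (cong (x +_) (sum-replicate-0 n)) (+-identityʳ x)
    where
    sum-replicate-0 : ∀ n → sum (toList (replicate n 0)) ≡ 0
    sum-replicate-0 zero    = refl
    sum-replicate-0 (suc n) = sum-replicate-0 n

  wsumU-vertex₁ : wsumU (x ∷ replicate n 0) ≡ x
  wsumU-vertex₁ = trans (cong₂ _+_ (+-identityʳ x) (∑-*-replicate-0 n (λ i → suc (suc (toℕ i))))) (+-identityʳ x)
    where
    ∑-*-replicate-0 : ∀ n (f : Fin n → ℕ) → ∑ (λ i → f i * lookup (replicate n 0) i) ≡ 0
    ∑-*-replicate-0 zero    f = refl
    ∑-*-replicate-0 (suc n) f =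
      trans (cong (_+ ∑ (λ i → f (suc i) * lookup (replicate n 0) i)) (*-zeroʳ (f zero)))
            (∑-*-replicate-0 n (λ i → f (suc i)))

  objective-vertex₁ : ∀ i₁ s₁ s₂ → objective i₁ (suc n) s₁ s₂ (x ∷ replicate n 0)
    ≡ (s₂ ∸ x) * D₁ i₁ (suc n) s₁ + x * coef i₁ (suc n) s₁ zero
  objective-vertex₁ i₁ s₁ s₂ =
    cong₂ (λ t C → (s₂ ∸ t) * D₁ i₁ (suc n) s₁ + C) sumU-vertex₁
      (trans (cong (x * coef i₁ (suc n) s₁ zero +_) (replicate-0-*-∑ n (λ i → coef i₁ (suc n) s₁ (suc i))))
             (+-identityʳ _))
    where
    replicate-0-*-∑ : ∀ n (f : Fin n → ℕ) → ∑ (λ i → lookup (replicate n 0) i * f i) ≡ 0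
    replicate-0-*-∑ zero    f = refl
    replicate-0-*-∑ (suc n) f = replicate-0-*-∑ n (λ i → f (suc i))

-- Arithmetic of the dual certificates

m+[n+o]∸n≡m+o : ∀ m n o → m + (n + o) ∸ n ≡ m + o
m+[n+o]∸n≡m+o m n o = trans (cong (_∸ n) (reorder m n o)) (m+n∸m≡n n (m + o))
  where
  reorder : ∀ m n o → m + (n + o) ≡ n + (m + o)
  reorder = solve-∀

m*o+n*[p∸o]≡[m∸n]*o+n*p : ∀ {m n o p} → o ≤ p → n ≤ m → m * o + n * (p ∸ o) ≡ (m ∸ n) * o + n * p
m*o+n*[p∸o]≡[m∸n]*o+n*p {n = n} {o} o≤p n≤m with m≤n⇒∃[o]m+o≡n o≤p | m≤n⇒∃[o]m+o≡n n≤m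
... | d , refl | t , refl rewrite m+n∸m≡n o d | m+n∸m≡n n t = reorder n t o d
  where
  reorder : ∀ n t o d → (n + t) * o + n * d ≡ t * o + n * (o + d)
  reorder = solve-∀

-- For j ≤ k the bound (r - j) c ≤ i₁ suffices, because r m ≤ (m + j)(r - j).
near-coef-≤ : ∀ {r} m {k j c i₁} → r ≡ m + k → j ≤ k → (r ∸ j) * c ≤ i₁ → r * m * c ≤ (m + j) * i₁
near-coef-≤ m {j = j} {c} {i₁} refl j≤k [r-j]c≤i₁ with m≤n⇒∃[o]m+o≡n j≤k
... | d , refl = begin
  (m + (j + d)) * m * c                   ≤⟨ m≤m+n _ (j * d * c) ⟩
  (m + (j + d)) * m * c + j * d * c       ≡⟨ reorder m j d c ⟩
  (m + j) * ((m + d) * c)                 ≡⟨ cong (λ e → (m + j) * (e * c)) (m+[n+o]∸n≡m+o m j d) ⟨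
  (m + j) * ((m + (j + d) ∸ j) * c)       ≤⟨ *-monoʳ-≤ (m + j) [r-j]c≤i₁ ⟩
  (m + j) * i₁                            ∎
  where
  open ≤-Reasoning
  reorder : ∀ m j d c → (m + (j + d)) * m * c + j * d * c ≡ (m + j) * ((m + d) * c)
  reorder = solve-∀

far-coef-≤-above : ∀ {r} m {k j c s₁ i₁} → r ≡ m + k → k < j → c ≤ s₁ → m * r * s₁ ≤ suc r * i₁ →
  r * m * c ≤ (m + j) * i₁
far-coef-≤-above {r} m {k} {j} {c} {s₁} {i₁} r≡m+k k<j c≤s₁ mrs₁≤[1+r]i₁ = begin
  r * m * c      ≤⟨ *-monoʳ-≤ (r * m) c≤s₁ ⟩
  r * m * s₁     ≡⟨ cong (_* s₁) (*-comm r m) ⟩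
  m * r * s₁     ≤⟨ mrs₁≤[1+r]i₁ ⟩
  suc r * i₁     ≤⟨ *-monoˡ-≤ i₁ 1+r≤m+j ⟩
  (m + j) * i₁   ∎
  where
  open ≤-Reasoning
  1+r≤m+j : suc r ≤ m + j
  1+r≤m+j = subst (_≤ m + j) (sym (trans (cong suc r≡m+k) (sym (+-suc m k)))) (+-monoʳ-≤ m k<j)

near-coef-≤-below : ∀ {r} m {k j c i₁ g} .{{_ : NonZero m}} → r ≡ m + k → j ≤ k → (r ∸ j) * c ≤ i₁ →
  suc k * i₁ ≤ m * g → r * suc k * c ≤ suc k * i₁ + j * g
near-coef-≤-below m {j = j} {c} {i₁} {g} refl j≤k [r-j]c≤i₁ Ki₁≤mg with m≤n⇒∃[o]m+o≡n j≤k
... | d , refl = *-cancelˡ-≤ (m + d) {{m+d≢0}} (begin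
  (m + d) * (r * K * c)                      ≡⟨ reorder₁ m d r K c ⟩
  r * K * ((m + d) * c)                      ≡⟨ cong (λ e → r * K * (e * c)) (m+[n+o]∸n≡m+o m j d) ⟨
  r * K * ((r ∸ j) * c)                      ≤⟨ *-monoʳ-≤ (r * K) [r-j]c≤i₁ ⟩
  r * K * i₁                                 ≡⟨ reorder₂ m j d K i₁ ⟩
  (m + d) * (K * i₁) + j * (K * i₁)          ≤⟨ +-monoʳ-≤ ((m + d) * (K * i₁)) (*-monoʳ-≤ j Ki₁≤mg) ⟩
  (m + d) * (K * i₁) + j * (m * g)           ≤⟨ +-monoʳ-≤ ((m + d) * (K * i₁)) (*-monoʳ-≤ j (*-monoˡ-≤ g (m≤m+n m d))) ⟩
  (m + d) * (K * i₁) + j * ((m + d) * g)     ≡⟨ reorder₃ (m + d) (K * i₁) j g ⟩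
  (m + d) * (K * i₁ + j * g)                 ∎)
  where
  open ≤-Reasoning
  r = m + (j + d)
  K = suc (j + d)
  m+d≢0 : NonZero (m + d)
  m+d≢0 = >-nonZero (<-≤-trans (>-nonZero⁻¹ m) (m≤m+n m d))
  reorder₁ : ∀ m d r K c → (m + d) * (r * K * c) ≡ r * K * ((m + d) * c)
  reorder₁ = solve-∀
  reorder₂ : ∀ m j d K i → (m + (j + d)) * K * i ≡ (m + d) * (K * i) + j * (K * i)
  reorder₂ = solve-∀
  reorder₃ : ∀ e x j g → e * x + j * (e * g) ≡ e * (x + j * g)
  reorder₃ = solve-∀

vertex-decomposition : ∀ k s i → k * s ≤ i → i ≤ suc k * s →
  s ≡ (suc k * s ∸ i) + (i ∸ k * s) × i ≡ k * (suc k * s ∸ i) + suc k * (i ∸ k * s)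
vertex-decomposition k s i ks≤i i≤[1+k]s = s≡a+b , i≡ka+[1+k]b
  where
  a = suc k * s ∸ i
  b = i ∸ k * s
  ks+b≡i : k * s + b ≡ i
  ks+b≡i = m+[n∸m]≡n ks≤i
  s≡a+b : s ≡ a + b
  s≡a+b = +-cancelˡ-≡ (k * s) s (a + b) (begin
    k * s + s        ≡⟨ +-comm (k * s) s ⟩
    suc k * s        ≡⟨ m+[n∸m]≡n i≤[1+k]s ⟨
    i + a            ≡⟨ cong (_+ a) ks+b≡i ⟨
    k * s + b + a    ≡⟨ reorder (k * s) b a ⟩
    k * s + (a + b)  ∎)
    where
    open ≡-Reasoning
    reorder : ∀ x b a → x + b + a ≡ x + (a + b)
    reorder = solve-∀
  i≡ka+[1+k]b : i ≡ k * a + suc k * b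
  i≡ka+[1+k]b = begin
    i                      ≡⟨ ks+b≡i ⟨
    k * s + b              ≡⟨ cong (λ e → k * e + b) s≡a+b ⟩
    k * (a + b) + b        ≡⟨ reorder k a b ⟩
    k * a + suc k * b      ∎
    where
    open ≡-Reasoning
    reorder : ∀ k a b → k * (a + b) + b ≡ k * a + suc k * b
    reorder = solve-∀

threshold⇒rl≤i₁ : ∀ {m r s₁ i₁ l} → m * s₁ ≡ i₁ + l → m * r * s₁ ≤ suc r * i₁ → r * l ≤ i₁
threshold⇒rl≤i₁ {m} {r} {s₁} {i₁} {l} ms₁≡i₁+l mrs₁≤[1+r]i₁ = +-cancelˡ-≤ (r * i₁) (r * l) i₁ (begin
  r * i₁ + r * l    ≡⟨ *-distribˡ-+ r i₁ l ⟨
  r * (i₁ + l)      ≡⟨ cong (r *_) ms₁≡i₁+l ⟨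
  r * (m * s₁)      ≡⟨ reorder r m s₁ ⟩
  m * r * s₁        ≤⟨ mrs₁≤[1+r]i₁ ⟩
  i₁ + r * i₁       ≡⟨ +-comm i₁ (r * i₁) ⟩
  r * i₁ + i₁       ∎)
  where
  open ≤-Reasoning
  reorder : ∀ r m s → r * (m * s) ≡ m * r * s
  reorder = solve-∀

module _ (m k h l : ℕ) {r i₁ ms₁ : ℕ}
         (r≡m+k : r ≡ m + k) (i₁≡h+rl : i₁ ≡ h + r * l) (ms₁≡i₁+l : ms₁ ≡ i₁ + l) where

  regime₂-near-≤ : ∀ j → j ≤ k → (m + j) * i₁ ≤ m * i₁ + k * h + j * (r * l)
  regime₂-near-≤ j j≤k rewrite i₁≡h+rl = begin
    (m + j) * (h + r * l)                  ≡⟨ reorder m j h (r * l) ⟩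
    m * (h + r * l) + j * h + j * (r * l)  ≤⟨ +-monoˡ-≤ (j * (r * l)) (+-monoʳ-≤ (m * (h + r * l)) (*-monoˡ-≤ h j≤k)) ⟩
    m * (h + r * l) + k * h + j * (r * l)  ∎
    where
    open ≤-Reasoning
    reorder : ∀ m j h L → (m + j) * (h + L) ≡ m * (h + L) + j * h + j * L
    reorder = solve-∀

  regime₂-far-≡ : r * ms₁ ≡ m * i₁ + k * h + suc k * (r * l)
  regime₂-far-≡ rewrite ms₁≡i₁+l | i₁≡h+rl | r≡m+k = reorder m k h l
    where
    reorder : ∀ m k h l → (m + k) * (h + (m + k) * l + l) ≡ m * (h + (m + k) * l) + k * h + suc k * ((m + k) * l)
    reorder = solve-∀

  module _ (a b : ℕ) {s₂ i₂ : ℕ} (s₂≡a+b : s₂ ≡ a + b) (i₂≡ka+[1+k]b : i₂ ≡ k * a + suc k * b) where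

    regime₂-dual-≡ : s₂ * (m * i₁ + k * h) + i₂ * (r * l) ≡ r * (a * i₁ + b * ms₁)
    regime₂-dual-≡ rewrite s₂≡a+b | i₂≡ka+[1+k]b | ms₁≡i₁+l | i₁≡h+rl | r≡m+k = reorder m k h l a b
      where
      reorder : ∀ m k h l a b → let r = m + k in
        (a + b) * (m * (h + r * l) + k * h) + (k * a + suc k * b) * (r * l) ≡ r * (a * (h + r * l) + b * (h + r * l + l))
      reorder = solve-∀

    regime₂-primal-≤ : r * (a * i₁ + b * ms₁) ≤ m * i₁ * s₂ + ms₁ * i₂
    regime₂-primal-≤ rewrite s₂≡a+b | i₂≡ka+[1+k]b | ms₁≡i₁+l | i₁≡h+rl | r≡m+k =
      ≤-trans (m≤m+n _ (a * k * l + b * (h + suc k * l))) (≤-reflexive (reorder m k h l a b))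
      where
      reorder : ∀ m k h l a b → let r = m + k ; i₁ = h + r * l in
        r * (a * i₁ + b * (i₁ + l)) + (a * k * l + b * (h + suc k * l))
          ≡ m * i₁ * (a + b) + (i₁ + l) * (k * a + suc k * b)
      reorder = solve-∀

module _ (m k : ℕ) {r s₁ i₁ g : ℕ} (r≡m+k : r ≡ m + k) (rs₁≡i₁+g : r * s₁ ≡ i₁ + g) where

  [1+k]i₁≤mg : suc r * i₁ ≤ m * r * s₁ → suc k * i₁ ≤ m * g
  [1+k]i₁≤mg [1+r]i₁≤mrs₁ = +-cancelʳ-≤ (m * i₁) (suc k * i₁) (m * g) (begin
    suc k * i₁ + m * i₁     ≡⟨ reorder k m i₁ ⟩
    suc (m + k) * i₁        ≡⟨ cong (λ e → suc e * i₁) r≡m+k ⟨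
    suc r * i₁              ≤⟨ [1+r]i₁≤mrs₁ ⟩
    m * r * s₁              ≡⟨ *-assoc m r s₁ ⟩
    m * (r * s₁)            ≡⟨ cong (m *_) rs₁≡i₁+g ⟩
    m * (i₁ + g)            ≡⟨ *-distribˡ-+ m i₁ g ⟩
    m * i₁ + m * g          ≡⟨ +-comm (m * i₁) (m * g) ⟩
    m * g + m * i₁          ∎)
    where
    open ≤-Reasoning
    reorder : ∀ k m i → suc k * i + m * i ≡ suc (m + k) * i
    reorder = solve-∀

  g≤[1+k]s₁ : .{{_ : NonZero m}} → (m ∸ 1) * s₁ ≤ i₁ → g ≤ suc k * s₁
  g≤[1+k]s₁ [m-1]s₁≤i₁ = +-cancelˡ-≤ i₁ g (suc k * s₁) (begin
    i₁ + g                       ≡⟨ rs₁≡i₁+g ⟨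
    r * s₁                       ≡⟨ cong (_* s₁) r≡m+k ⟩
    (m + k) * s₁                 ≡⟨ split m ⟩
    (m ∸ 1) * s₁ + suc k * s₁    ≤⟨ +-monoˡ-≤ (suc k * s₁) [m-1]s₁≤i₁ ⟩
    i₁ + suc k * s₁              ∎)
    where
    open ≤-Reasoning
    split : ∀ m .{{_ : NonZero m}} → (m + k) * s₁ ≡ (m ∸ 1) * s₁ + suc k * s₁
    split (suc m) = reorder m k s₁
      where
      reorder : ∀ m k s → (suc m + k) * s ≡ m * s + suc k * s
      reorder = solve-∀

-- The four regimes

regime₄ : ∀ r s₁ s₂ i₁ i₂ .{{_ : NonZero r}} → s₁ * (r ∸ 1) ≤ i₁ → i₁ < s₁ * r → i₂ < s₂ →
  (D₂ i₁ i₂ r s₁ s₂ ≡ s₂ * (i₁ / r) + i₂ * (s₁ ∸ i₁ / r))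
  × (⟦ s₂ * (i₁ / r) + i₂ * (s₁ ∸ i₁ / r) ⟧ ≤ℚ frac (i₁ * s₂ + s₁ * i₂) r ⊓ℚ ⟦ s₁ * s₂ ⟧)
regime₄ r@(suc r₀) s₁ s₂ i₁ i₂ s₁r₀≤i₁ i₁<s₁r i₂<s₂ =
  ≤-antisym D₂≤V V≤D₂ ,
  ℚ.⊓-glb (·-mono-≤ (·-⟦⟧ r V) (·-frac (i₁ * s₂ + s₁ * i₂) r) rV≤) (⟦⟧-mono-≤ V≤s₁s₂)
  where
  q = i₁ / r
  V = s₂ * q + i₂ * (s₁ ∸ q)
  q≤s₁ : q ≤ s₁
  q≤s₁ = <⇒≤ (m<n*o⇒m/o<n i₁<s₁r)
  i₂≤s₂ = <⇒≤ i₂<s₂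
  r₀s₁≤i₁ : r₀ * s₁ ≤ i₁
  r₀s₁≤i₁ = ≤-trans (≤-reflexive (*-comm r₀ s₁)) s₁r₀≤i₁
  V≡ : V ≡ (s₂ ∸ i₂) * q + i₂ * s₁
  V≡ = m*o+n*[p∸o]≡[m∸n]*o+n*p q≤s₁ i₂≤s₂

  feasible : DualFeasible i₁ i₂ r s₁ s₂ 1 q (s₁ ∸ q)
  feasible zero    c _    rc≤i₁ = +-monoˡ-≤ 0 (m*n≤o⇒n≤o/m rc≤i₁)
  feasible (suc j) c c≤s₁ _     = begin
    1 * c                    ≡⟨ *-identityˡ c ⟩
    c                        ≤⟨ c≤s₁ ⟩
    s₁                       ≡⟨ m+[n∸m]≡n q≤s₁ ⟨
    q + (s₁ ∸ q)             ≤⟨ +-monoʳ-≤ q (m≤n*m (s₁ ∸ q) (suc j)) ⟩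
    q + suc j * (s₁ ∸ q)     ∎
    where open ≤-Reasoning

  D₂≤V : D₂ i₁ i₂ r s₁ s₂ ≤ V
  D₂≤V = ≤-trans (≤-reflexive (sym (*-identityˡ _))) (*-D₂-≤ i₁ i₂ r s₁ s₂ 1 q (s₁ ∸ q) feasible)

  V≤D₂ : V ≤ D₂ i₁ i₂ r s₁ s₂
  V≤D₂ = subst (_≤ D₂ i₁ i₂ r s₁ s₂) value-at-vertex
    (objective-≤-D₂ i₁ i₂ r s₁ s₂ (allVecs-complete s₂ vertex bounded)
      (≤-trans (≤-reflexive (sumU-vertex₁ i₂ r₀)) i₂≤s₂) (≤-reflexive (wsumU-vertex₁ i₂ r₀)))
    where
    vertex = i₂ ∷ replicate r₀ 0
    bounded : ∀ i → lookup vertex i ≤ s₂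
    bounded zero    = i₂≤s₂
    bounded (suc i) = subst (_≤ s₂) (sym (lookup-replicate i 0)) z≤n
    value-at-vertex : objective i₁ r s₁ s₂ vertex ≡ V
    value-at-vertex = begin
      objective i₁ r s₁ s₂ vertex                         ≡⟨ objective-vertex₁ i₂ r₀ i₁ s₁ s₂ ⟩
      (s₂ ∸ i₂) * D₁ i₁ r s₁ + i₂ * coef i₁ r s₁ zero     ≡⟨ cong₂ (λ D c → (s₂ ∸ i₂) * D + i₂ * c)
                                                              (m≤n⇒m⊓n≡m q≤s₁) (coef-saturated i₁ r₀ s₁ r₀s₁≤i₁) ⟩
      (s₂ ∸ i₂) * q + i₂ * s₁                             ≡⟨ V≡ ⟨
      V                                                   ∎
      where open ≡-Reasoning

  rV≤ : r * V ≤ i₁ * s₂ + s₁ * i₂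
  rV≤ = begin
    r * V                                          ≡⟨ cong (r *_) V≡ ⟩
    r * ((s₂ ∸ i₂) * q + i₂ * s₁)                  ≡⟨ reorder₁ r₀ (s₂ ∸ i₂) q i₂ s₁ ⟩
    (s₂ ∸ i₂) * (r * q) + i₂ * (s₁ + r₀ * s₁)      ≤⟨ +-mono-≤ (*-monoʳ-≤ (s₂ ∸ i₂) (m*[n/m]≤n r i₁))
                                                       (*-monoʳ-≤ i₂ (+-monoʳ-≤ s₁ r₀s₁≤i₁)) ⟩
    (s₂ ∸ i₂) * i₁ + i₂ * (s₁ + i₁)                ≡⟨ reorder₂ (s₂ ∸ i₂) i₁ i₂ s₁ ⟩
    i₁ * (s₂ ∸ i₂ + i₂) + s₁ * i₂                  ≡⟨ cong (λ s → i₁ * s + s₁ * i₂) (m∸n+n≡m i₂≤s₂) ⟩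
    i₁ * s₂ + s₁ * i₂                              ∎
    where
    open ≤-Reasoning
    reorder₁ : ∀ r₀ t q i s → suc r₀ * (t * q + i * s) ≡ t * (suc r₀ * q) + i * (s + r₀ * s)
    reorder₁ = solve-∀
    reorder₂ : ∀ t i₁ i s → t * i₁ + i * (s + i₁) ≡ i₁ * (t + i) + s * i
    reorder₂ = solve-∀

  V≤s₁s₂ : V ≤ s₁ * s₂
  V≤s₁s₂ = begin
    V                                ≡⟨ V≡ ⟩
    (s₂ ∸ i₂) * q + i₂ * s₁          ≤⟨ +-monoˡ-≤ (i₂ * s₁) (*-monoʳ-≤ (s₂ ∸ i₂) q≤s₁) ⟩
    (s₂ ∸ i₂) * s₁ + i₂ * s₁         ≡⟨ *-distribʳ-+ s₁ (s₂ ∸ i₂) i₂ ⟨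
    (s₂ ∸ i₂ + i₂) * s₁              ≡⟨ cong (_* s₁) (m∸n+n≡m i₂≤s₂) ⟩
    s₂ * s₁                          ≡⟨ *-comm s₂ s₁ ⟩
    s₁ * s₂                          ∎
    where open ≤-Reasoning

module Regimes (r s₁ s₂ i₁ i₂ : ℕ) .{{_ : NonZero r}} (m k : ℕ) .{{_ : NonZero m}} (r≡m+k : r ≡ m + k) where

  threshold-scaled : suc r · ⟦ m ⟧ *ℚ frac r (suc r) *ℚ ⟦ s₁ ⟧ ≡⟦ m * r * s₁ ⟧
  threshold-scaled = ·-*ʳ s₁ (·-*ˡ m (·-frac r (suc r)))

  module AboveThreshold (above : ⟦ m ⟧ *ℚ frac r (suc r) *ℚ ⟦ s₁ ⟧ ≤ℚ ⟦ i₁ ⟧) (i₁<ms₁ : i₁ < m * s₁) where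

    mrs₁≤[1+r]i₁ : m * r * s₁ ≤ suc r * i₁
    mrs₁≤[1+r]i₁ = ·-cancel-≤ threshold-scaled (·-⟦⟧ (suc r) i₁) above

    i₁≤ms₁ : i₁ ≤ m * s₁
    i₁≤ms₁ = <⇒≤ i₁<ms₁

    coef-≤-above : ∀ j c → c ≤ s₁ → (r ∸ j) * c ≤ i₁ → r * m * c ≤ (m + j) * i₁
    coef-≤-above j c c≤s₁ [r-j]c≤i₁ with j ≤? k
    ... | yes j≤k = near-coef-≤ m r≡m+k j≤k [r-j]c≤i₁
    ... | no  j≰k = far-coef-≤-above m r≡m+k (≰⇒> j≰k) c≤s₁ mrs₁≤[1+r]i₁

    regime₁ : i₂ < k * s₂ →
      (⟦ D₂ i₁ i₂ r s₁ s₂ ⟧ ≤ℚ ⟦ s₂ ⟧ *ℚ frac i₁ r +ℚ frac i₂ r *ℚ frac i₁ m)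
      × (⟦ s₂ ⟧ *ℚ frac i₁ r +ℚ frac i₂ r *ℚ frac i₁ m ≤ℚ frac (i₁ * s₂ + s₁ * i₂) r ⊓ℚ ⟦ s₁ * s₂ ⟧)
    regime₁ i₂<ks₂ = ·-bounds r m Q≐X (*-D₂-≤ i₁ i₂ r s₁ s₂ (r * m) (m * i₁) i₁ feasible) X≤m[…] X≤rm[s₁s₂]
      where
      X = s₂ * (m * i₁) + i₂ * i₁
      feasible : DualFeasible i₁ i₂ r s₁ s₂ (r * m) (m * i₁) i₁
      feasible j c c≤s₁ [r-j]c≤i₁ = subst (r * m * c ≤_) (*-distribʳ-+ i₁ m j) (coef-≤-above j c c≤s₁ [r-j]c≤i₁)
      Q≐X : r * m · ⟦ s₂ ⟧ *ℚ frac i₁ r +ℚ frac i₂ r *ℚ frac i₁ m ≡⟦ X ⟧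
      Q≐X = ·-+ (·-*ˡ s₂ (·-scaleʳ m (·-frac i₁ r))) (·-* (·-frac i₂ r) (·-frac i₁ m))
      X≤m[…] : X ≤ m * (i₁ * s₂ + s₁ * i₂)
      X≤m[…] = begin
        s₂ * (m * i₁) + i₂ * i₁          ≤⟨ +-monoʳ-≤ (s₂ * (m * i₁)) (*-monoʳ-≤ i₂ i₁≤ms₁) ⟩
        s₂ * (m * i₁) + i₂ * (m * s₁)    ≡⟨ reorder s₂ m i₁ i₂ s₁ ⟩
        m * (i₁ * s₂ + s₁ * i₂)          ∎
        where
        open ≤-Reasoning
        reorder : ∀ s₂ m i₁ i₂ s₁ → s₂ * (m * i₁) + i₂ * (m * s₁) ≡ m * (i₁ * s₂ + s₁ * i₂)
        reorder = solve-∀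
      X≤rm[s₁s₂] : X ≤ r * m * (s₁ * s₂)
      X≤rm[s₁s₂] = begin
        s₂ * (m * i₁) + i₂ * i₁                  ≤⟨ +-mono-≤ (*-monoʳ-≤ s₂ (*-monoʳ-≤ m i₁≤ms₁))
                                                                (*-mono-≤ (<⇒≤ i₂<ks₂) i₁≤ms₁) ⟩
        s₂ * (m * (m * s₁)) + k * s₂ * (m * s₁)  ≡⟨ reorder s₂ m k s₁ ⟩
        (m + k) * m * (s₁ * s₂)                  ≡⟨ cong (λ e → e * m * (s₁ * s₂)) r≡m+k ⟨
        r * m * (s₁ * s₂)                        ∎
        where
        open ≤-Reasoning
        reorder : ∀ s₂ m k s₁ → s₂ * (m * (m * s₁)) + k * s₂ * (m * s₁) ≡ (m + k) * m * (s₁ * s₂)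
        reorder = solve-∀

    -- The bound is the objective at the vertex u_k = a, u_{k+1} = b with D(i₁, r - k, s₁) replaced
    -- by i₁ / (r - k); the dual certificate below makes both constraints tight there.
    regime₂ : k * s₂ ≤ i₂ → i₂ < suc k * s₂ →
      (⟦ D₂ i₁ i₂ r s₁ s₂ ⟧
         ≤ℚ ⟦ s₂ ⟧ *ℚ frac i₁ r
            +ℚ ⟦ suc k * s₂ ∸ i₂ ⟧ *ℚ (frac i₁ m -ℚ frac i₁ r)
            +ℚ ⟦ i₂ ∸ k * s₂ ⟧ *ℚ (⟦ s₁ ⟧ -ℚ frac i₁ r))
      × (⟦ s₂ ⟧ *ℚ frac i₁ r
            +ℚ ⟦ suc k * s₂ ∸ i₂ ⟧ *ℚ (frac i₁ m -ℚ frac i₁ r)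
            +ℚ ⟦ i₂ ∸ k * s₂ ⟧ *ℚ (⟦ s₁ ⟧ -ℚ frac i₁ r)
         ≤ℚ frac (i₁ * s₂ + s₁ * i₂) r ⊓ℚ ⟦ s₁ * s₂ ⟧)
    regime₂ ks₂≤i₂ i₂<[1+k]s₂ = ·-bounds r m Q≐rY rmD₂≤rY rY≤m[…] rY≤rm[s₁s₂]
      where
      a = suc k * s₂ ∸ i₂
      b = i₂ ∸ k * s₂
      s₂≡a+b = proj₁ (vertex-decomposition k s₂ i₂ ks₂≤i₂ (<⇒≤ i₂<[1+k]s₂))
      i₂≡ka+[1+k]b = proj₂ (vertex-decomposition k s₂ i₂ ks₂≤i₂ (<⇒≤ i₂<[1+k]s₂))
      l = m * s₁ ∸ i₁
      ms₁≡i₁+l : m * s₁ ≡ i₁ + l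
      ms₁≡i₁+l = sym (m+[n∸m]≡n i₁≤ms₁)
      h = i₁ ∸ r * l
      i₁≡h+rl : i₁ ≡ h + r * l
      i₁≡h+rl = sym (m∸n+n≡m (threshold⇒rl≤i₁ {m} {r} {s₁} ms₁≡i₁+l mrs₁≤[1+r]i₁))
      Y = a * i₁ + b * (m * s₁)

      feasible : DualFeasible i₁ i₂ r s₁ s₂ (r * m) (m * i₁ + k * h) (r * l)
      feasible j c c≤s₁ [r-j]c≤i₁ with j ≤? k
      ... | yes j≤k = ≤-trans (near-coef-≤ m r≡m+k j≤k [r-j]c≤i₁)
                              (regime₂-near-≤ m k h l r≡m+k i₁≡h+rl ms₁≡i₁+l j j≤k)
      ... | no  j≰k = begin
        r * m * c                                 ≤⟨ *-monoʳ-≤ (r * m) c≤s₁ ⟩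
        r * m * s₁                                ≡⟨ *-assoc r m s₁ ⟩
        r * (m * s₁)                              ≡⟨ regime₂-far-≡ m k h l r≡m+k i₁≡h+rl ms₁≡i₁+l ⟩
        m * i₁ + k * h + suc k * (r * l)          ≤⟨ +-monoʳ-≤ (m * i₁ + k * h) (*-monoˡ-≤ (r * l) (≰⇒> j≰k)) ⟩
        m * i₁ + k * h + j * (r * l)              ∎
        where open ≤-Reasoning

      rmD₂≤rY : r * m * D₂ i₁ i₂ r s₁ s₂ ≤ r * Y
      rmD₂≤rY = ≤-trans (*-D₂-≤ i₁ i₂ r s₁ s₂ (r * m) (m * i₁ + k * h) (r * l) feasible)
        (≤-reflexive (regime₂-dual-≡ m k h l r≡m+k i₁≡h+rl ms₁≡i₁+l a b s₂≡a+b i₂≡ka+[1+k]b))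

      fr = frac i₁ r
      fm = frac i₁ m

      Q≐rY : r * m · ⟦ s₂ ⟧ *ℚ fr +ℚ ⟦ a ⟧ *ℚ (fm -ℚ fr) +ℚ ⟦ b ⟧ *ℚ (⟦ s₁ ⟧ -ℚ fr) ≡⟦ r * Y ⟧
      Q≐rY = subst (λ Q → r * m · Q ≡⟦ r * Y ⟧) (sym Q≡vertex)
        (·-scaleˡ r (·-+ (·-*ˡ a (·-frac i₁ m)) (·-*ˡ b (·-⟦⟧ m s₁))))
        where
        Q≡vertex : ⟦ s₂ ⟧ *ℚ fr +ℚ ⟦ a ⟧ *ℚ (fm -ℚ fr) +ℚ ⟦ b ⟧ *ℚ (⟦ s₁ ⟧ -ℚ fr) ≡ ⟦ a ⟧ *ℚ fm +ℚ ⟦ b ⟧ *ℚ ⟦ s₁ ⟧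
        Q≡vertex = begin
          ⟦ s₂ ⟧ *ℚ fr +ℚ ⟦ a ⟧ *ℚ (fm -ℚ fr) +ℚ ⟦ b ⟧ *ℚ (⟦ s₁ ⟧ -ℚ fr)
            ≡⟨ cong (λ S → S *ℚ fr +ℚ ⟦ a ⟧ *ℚ (fm -ℚ fr) +ℚ ⟦ b ⟧ *ℚ (⟦ s₁ ⟧ -ℚ fr))
                 (trans (cong ⟦_⟧ s₂≡a+b) (⟦⟧-+ a b)) ⟩
          (⟦ a ⟧ +ℚ ⟦ b ⟧) *ℚ fr +ℚ ⟦ a ⟧ *ℚ (fm -ℚ fr) +ℚ ⟦ b ⟧ *ℚ (⟦ s₁ ⟧ -ℚ fr)
            ≡⟨ solveℚ 5 (λ a b s f g → (a :+ b) :* f :+ a :* (g :- f) :+ b :* (s :- f) := a :* g :+ b :* s)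
                 refl ⟦ a ⟧ ⟦ b ⟧ ⟦ s₁ ⟧ fr fm ⟩
          ⟦ a ⟧ *ℚ fm +ℚ ⟦ b ⟧ *ℚ ⟦ s₁ ⟧
            ∎
          where open ≡-Reasoning

      rY≤m[…] : r * Y ≤ m * (i₁ * s₂ + s₁ * i₂)
      rY≤m[…] = ≤-trans (regime₂-primal-≤ m k h l r≡m+k i₁≡h+rl ms₁≡i₁+l a b s₂≡a+b i₂≡ka+[1+k]b)
        (≤-reflexive (reorder m i₁ s₂ s₁ i₂))
        where
        reorder : ∀ m i₁ s₂ s₁ i₂ → m * i₁ * s₂ + m * s₁ * i₂ ≡ m * (i₁ * s₂ + s₁ * i₂)
        reorder = solve-∀

      rY≤rm[s₁s₂] : r * Y ≤ r * m * (s₁ * s₂)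
      rY≤rm[s₁s₂] = begin
        r * (a * i₁ + b * (m * s₁))            ≤⟨ *-monoʳ-≤ r (+-monoˡ-≤ (b * (m * s₁)) (*-monoʳ-≤ a i₁≤ms₁)) ⟩
        r * (a * (m * s₁) + b * (m * s₁))      ≡⟨ cong (r *_) (*-distribʳ-+ (m * s₁) a b) ⟨
        r * ((a + b) * (m * s₁))               ≡⟨ cong (λ e → r * (e * (m * s₁))) s₂≡a+b ⟨
        r * (s₂ * (m * s₁))                    ≡⟨ reorder r s₂ m s₁ ⟩
        r * m * (s₁ * s₂)                      ∎
        where
        open ≤-Reasoning
        reorder : ∀ r s₂ m s₁ → r * (s₂ * (m * s₁)) ≡ r * m * (s₁ * s₂)
        reorder = solve-∀

  regime₃ : (m ∸ 1) * s₁ ≤ i₁ → ⟦ i₁ ⟧ <ℚ ⟦ m ⟧ *ℚ frac r (suc r) *ℚ ⟦ s₁ ⟧ → i₂ < suc k * s₂ →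
    (⟦ D₂ i₁ i₂ r s₁ s₂ ⟧ ≤ℚ ⟦ s₂ ⟧ *ℚ frac i₁ r +ℚ frac i₂ (suc k) *ℚ (⟦ s₁ ⟧ -ℚ frac i₁ r))
    × (⟦ s₂ ⟧ *ℚ frac i₁ r +ℚ frac i₂ (suc k) *ℚ (⟦ s₁ ⟧ -ℚ frac i₁ r)
         ≤ℚ frac (i₁ * s₂ + s₁ * i₂) r ⊓ℚ ⟦ s₁ * s₂ ⟧)
  regime₃ [m-1]s₁≤i₁ below i₂<Ks₂ =
    ·-bounds r K Q≐X (*-D₂-≤ i₁ i₂ r s₁ s₂ (r * K) (K * i₁) g feasible) X≤K[…] X≤rK[s₁s₂]
    where
    K = suc k
    [1+r]i₁<mrs₁ : suc r * i₁ < m * r * s₁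
    [1+r]i₁<mrs₁ = ·-cancel-< (·-⟦⟧ (suc r) i₁) threshold-scaled below
    i₁≤rs₁ : i₁ ≤ r * s₁
    i₁≤rs₁ = ≤-trans (*-cancelˡ-≤ r (begin
      r * i₁           ≤⟨ m≤n+m (r * i₁) i₁ ⟩
      suc r * i₁       ≤⟨ <⇒≤ [1+r]i₁<mrs₁ ⟩
      m * r * s₁       ≡⟨ cong (_* s₁) (*-comm m r) ⟩
      r * m * s₁       ≡⟨ *-assoc r m s₁ ⟩
      r * (m * s₁)     ∎))
      (*-monoˡ-≤ s₁ (subst (m ≤_) (sym r≡m+k) (m≤m+n m k)))
      where open ≤-Reasoning
    g = r * s₁ ∸ i₁
    rs₁≡i₁+g : r * s₁ ≡ i₁ + g
    rs₁≡i₁+g = sym (m+[n∸m]≡n i₁≤rs₁)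
    X = s₂ * (K * i₁) + i₂ * g

    feasible : DualFeasible i₁ i₂ r s₁ s₂ (r * K) (K * i₁) g
    feasible j c c≤s₁ [r-j]c≤i₁ with j ≤? k
    ... | yes j≤k = near-coef-≤-below m r≡m+k j≤k [r-j]c≤i₁
                      ([1+k]i₁≤mg m k r≡m+k rs₁≡i₁+g (<⇒≤ [1+r]i₁<mrs₁))
    ... | no  j≰k = begin
      r * K * c           ≤⟨ *-monoʳ-≤ (r * K) c≤s₁ ⟩
      r * K * s₁          ≡⟨ reorder r K s₁ ⟩
      K * (r * s₁)        ≡⟨ cong (K *_) rs₁≡i₁+g ⟩
      K * (i₁ + g)        ≡⟨ *-distribˡ-+ K i₁ g ⟩
      K * i₁ + K * g      ≤⟨ +-monoʳ-≤ (K * i₁) (*-monoˡ-≤ g (≰⇒> j≰k)) ⟩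
      K * i₁ + j * g      ∎
      where
      open ≤-Reasoning
      reorder : ∀ r K s → r * K * s ≡ K * (r * s)
      reorder = solve-∀

    Q≐X : r * K · ⟦ s₂ ⟧ *ℚ frac i₁ r +ℚ frac i₂ K *ℚ (⟦ s₁ ⟧ -ℚ frac i₁ r) ≡⟦ X ⟧
    Q≐X = ·-+ (·-*ˡ s₂ (·-scaleʳ K (·-frac i₁ r)))
      (subst (_· frac i₂ K *ℚ (⟦ s₁ ⟧ -ℚ frac i₁ r) ≡⟦ i₂ * g ⟧) (*-comm K r)
        (·-* (·-frac i₂ K) (·-∸ (·-⟦⟧ r s₁) (·-frac i₁ r) i₁≤rs₁)))

    X≤K[…] : X ≤ K * (i₁ * s₂ + s₁ * i₂)
    X≤K[…] = begin
      s₂ * (K * i₁) + i₂ * g           ≤⟨ +-monoʳ-≤ (s₂ * (K * i₁)) (*-monoʳ-≤ i₂ g≤Ks₁) ⟩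
      s₂ * (K * i₁) + i₂ * (K * s₁)    ≡⟨ reorder s₂ K i₁ i₂ s₁ ⟩
      K * (i₁ * s₂ + s₁ * i₂)          ∎
      where
      open ≤-Reasoning
      g≤Ks₁ = g≤[1+k]s₁ m k r≡m+k rs₁≡i₁+g [m-1]s₁≤i₁
      reorder : ∀ s₂ K i₁ i₂ s₁ → s₂ * (K * i₁) + i₂ * (K * s₁) ≡ K * (i₁ * s₂ + s₁ * i₂)
      reorder = solve-∀

    X≤rK[s₁s₂] : X ≤ r * K * (s₁ * s₂)
    X≤rK[s₁s₂] = begin
      s₂ * (K * i₁) + i₂ * g           ≤⟨ +-monoʳ-≤ (s₂ * (K * i₁)) (*-monoˡ-≤ g (<⇒≤ i₂<Ks₂)) ⟩
      s₂ * (K * i₁) + K * s₂ * g       ≡⟨ reorder₁ s₂ K i₁ g ⟩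
      K * s₂ * (i₁ + g)                ≡⟨ cong (K * s₂ *_) rs₁≡i₁+g ⟨
      K * s₂ * (r * s₁)                ≡⟨ reorder₂ K s₂ r s₁ ⟩
      r * K * (s₁ * s₂)                ∎
      where
      open ≤-Reasoning
      reorder₁ : ∀ s₂ K i₁ g → s₂ * (K * i₁) + K * s₂ * g ≡ K * s₂ * (i₁ + g)
      reorder₁ = solve-∀
      reorder₂ : ∀ K s₂ r s₁ → K * s₂ * (r * s₁) ≡ r * K * (s₁ * s₂)
      reorder₂ = solve-∀

proposition19 :
  (r s₁ s₂ i₁ i₂ : ℕ) → .{{_ : NonZero r}} → 1 ≤ s₁ → 1 ≤ s₂ →
  ((k : ℕ) → 1 ≤ k → k < r →
    -- (C.1)
    ((⟦ r ∸ k ⟧ *ℚ frac r (suc r) *ℚ ⟦ s₁ ⟧ ≤ℚ ⟦ i₁ ⟧ → i₁ < (r ∸ k) * s₁ → i₂ < k * s₂ →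
        (⟦ D₂ i₁ i₂ r s₁ s₂ ⟧
           ≤ℚ ⟦ s₂ ⟧ *ℚ frac i₁ r +ℚ frac i₂ r *ℚ frac i₁ (r ∸ k))
      × (⟦ s₂ ⟧ *ℚ frac i₁ r +ℚ frac i₂ r *ℚ frac i₁ (r ∸ k)
           ≤ℚ frac (i₁ * s₂ + s₁ * i₂) r ⊓ℚ ⟦ s₁ * s₂ ⟧))
    -- (C.2)
    × (⟦ r ∸ k ⟧ *ℚ frac r (suc r) *ℚ ⟦ s₁ ⟧ ≤ℚ ⟦ i₁ ⟧ → i₁ < (r ∸ k) * s₁ →
       k * s₂ ≤ i₂ → i₂ < (suc k) * s₂ →
        (⟦ D₂ i₁ i₂ r s₁ s₂ ⟧
           ≤ℚ ⟦ s₂ ⟧ *ℚ frac i₁ r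
              +ℚ ⟦ suc k * s₂ ∸ i₂ ⟧ *ℚ (frac i₁ (r ∸ k) -ℚ frac i₁ r)
              +ℚ ⟦ i₂ ∸ k * s₂ ⟧ *ℚ (⟦ s₁ ⟧ -ℚ frac i₁ r))
      × (⟦ s₂ ⟧ *ℚ frac i₁ r
              +ℚ ⟦ suc k * s₂ ∸ i₂ ⟧ *ℚ (frac i₁ (r ∸ k) -ℚ frac i₁ r)
              +ℚ ⟦ i₂ ∸ k * s₂ ⟧ *ℚ (⟦ s₁ ⟧ -ℚ frac i₁ r)
           ≤ℚ frac (i₁ * s₂ + s₁ * i₂) r ⊓ℚ ⟦ s₁ * s₂ ⟧))
    -- (C.3)
    × ((r ∸ k ∸ 1) * s₁ ≤ i₁ → ⟦ i₁ ⟧ <ℚ ⟦ r ∸ k ⟧ *ℚ frac r (suc r) *ℚ ⟦ s₁ ⟧ →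
       i₂ < suc k * s₂ →
        (⟦ D₂ i₁ i₂ r s₁ s₂ ⟧
           ≤ℚ ⟦ s₂ ⟧ *ℚ frac i₁ r +ℚ frac i₂ (suc k) *ℚ (⟦ s₁ ⟧ -ℚ frac i₁ r))
      × (⟦ s₂ ⟧ *ℚ frac i₁ r +ℚ frac i₂ (suc k) *ℚ (⟦ s₁ ⟧ -ℚ frac i₁ r)
           ≤ℚ frac (i₁ * s₂ + s₁ * i₂) r ⊓ℚ ⟦ s₁ * s₂ ⟧))))
  -- (C.4)
  × (s₁ * (r ∸ 1) ≤ i₁ → i₁ < s₁ * r → i₂ < s₂ →
      (D₂ i₁ i₂ r s₁ s₂ ≡ s₂ * (i₁ / r) + i₂ * (s₁ ∸ i₁ / r))
    × (⟦ s₂ * (i₁ / r) + i₂ * (s₁ ∸ i₁ / r) ⟧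
         ≤ℚ frac (i₁ * s₂ + s₁ * i₂) r ⊓ℚ ⟦ s₁ * s₂ ⟧))
proposition19 r s₁ s₂ i₁ i₂ _ _ =
  (λ k _ k<r →
    let open Regimes r s₁ s₂ i₁ i₂ (r ∸ k) k {{>-nonZero (m<n⇒0<n∸m k<r)}} (sym (m∸n+n≡m (<⇒≤ k<r)))
    in AboveThreshold.regime₁ , AboveThreshold.regime₂ , regime₃) ,
  regime₄ r s₁ s₂ i₁ i₂
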